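{- Let $T$ be a bridging triangulation of the annulus $C_{p,q}$, $Q_T$ its associated quiver, and let $Q_\partial$ and $Q_{\partial'}$ be constructed from $Q_T$ as follows: draw $Q_T$ (whose underlying graph is an unoriented cycle) as a planar cycle; $Q_\partial$ is obtained by replacing every maximal counter-clockwise oriented path $i\to\cdots\to j$ in $Q_T$ by a single vertex, and $Q_{\partial'}$ is obtained by replacing every maximal clockwise oriented path $r\to\cdots\to s$ in $Q_T$ by a single vertex. Then \[Q_{D_z^{+\infty}(T)}\cong Q_\partial\sqcup Q_{\partial'}.\]
   Context: $C_{p,q}$ is an annulus with $p>0$ marked points on the outer boundary $\partial$ and $q>0$ on the inner boundary $\partial'$, oriented counter-clockwise; $z$ is a non-contractible simple closed curve in it. Arcs are taken up to isotopy; a triangulation is a maximal collection of pairwise non-crossing arcs; a bridging triangulation has all arcs joining $\partial$ to $\partial'$. The quiver $Q_T$ of a (possibly asymptotic) triangulation has a vertex for each arc $d_i$ and an arrow $i\to j$ whenever $d_i,d_j$ bound a common triangle and $d_j$ is a clockwise rotation of $d_i$ about their common endpoint. In the drawing convention used, a maximal counter-clockwise path $i\to\cdots\to j$ in $Q_T$ corresponds to a maximal family of consecutive arcs $d_i,\dots,d_j$ sharing a common endpoint on $\partial$, and a maximal clockwise path to a maximal family of consecutive arcs sharing a common endpoint on $\partial'$. For a marked point $m$, the Prüfer arc $\pi_m$ starts at $m$ and spirals positively around the annulus towards $z$. $D_z^{+\infty}(T)$ is the limit of infinitely many positive Dehn twists along $z$ (rotating the inner boundary clockwise by $2\pi$ each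 time) applied to $T$; concretely each bridging arc $[i,j]$ becomes the pair $\{\pi_i,\pi_j\}$ and peripheral arcs are unchanged, and $D_z^{+\infty}(T)$ is the union of these, an asymptotic triangulation. -}

module Defs where

open import Data.Nat as ℕ using (ℕ; NonZero; _∸_)
open import Data.Nat.DivMod using (_mod_)
open import Data.Integer as ℤ using (ℤ; +_; _+_; _*_; _<_; 1ℤ; _%ℕ_)
open import Data.Fin as Fin using (Fin; toℕ; splitAt)
open import Data.Fin.Properties using () renaming (_≟_ to _≟F_)
open import Data.Sum using (_⊎_; inj₁; inj₂)
open import Data.Sum.Properties using (≡-dec)
open import Data.Product using (Σ; _×_; _,_; ∃)
open import Data.Empty using (⊥)
open import Data.Unit using (⊤)
open import Data.List.Relation.Unary.All using (All)
open import Data.List using (List; []; _∷_; length; lookup; concatMap; deduplicate)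
open import Data.List.Membership.Propositional using (_∈_; _∉_)
open import Data.List.Relation.Unary.Any using (Any)
open import Data.List.Relation.Unary.Unique.Propositional using (Unique)
open import Relation.Nullary using (¬_)
open import Relation.Binary.PropositionalEquality using (_≡_)
open import Relation.Binary.Construct.Closure.Equivalence using (EqClosure)
open import Function.Bundles using (_↔_; Inverse)

record Quiver : Set₁ where
  field
    n   : ℕ
    Arr : Fin n → Fin n → Set

open Quiver public

_≅Q_ : Quiver → Quiver → Set
Q ≅Q Q' = Σ (Fin (n Q) ↔ Fin (n Q')) λ σ →
  ∀ i j → Arr Q i j ↔ Arr Q' (Inverse.to σ i) (Inverse.to σ j)

⊔Arr : ∀ {n₁ n₂} (A₁ : Fin n₁ → Fin n₁ → Set) (A₂ : Fin n₂ → Fin n₂ → Set) →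
       Fin n₁ ⊎ Fin n₂ → Fin n₁ ⊎ Fin n₂ → Set
⊔Arr A₁ A₂ (inj₁ x) (inj₁ y) = A₁ x y
⊔Arr A₁ A₂ (inj₂ x) (inj₂ y) = A₂ x y
⊔Arr A₁ A₂ _        _        = ⊥

_⊔Q_ : Quiver → Quiver → Quiver
Q₁ ⊔Q Q₂ = record
  { n   = n Q₁ ℕ.+ n Q₂
  ; Arr = λ i j → ⊔Arr (Arr Q₁) (Arr Q₂) (splitAt (n Q₁) i) (splitAt (n Q₁) j)
  }

-- Q' is (up to isomorphism) the quiver obtained from a quiver with vertex
-- set Fin m and arrows  C ⊎ K  by contracting every connected family of
-- C-arrows to a single vertex: there is a surjection f from the old
-- vertices onto the vertices of Q' identifying exactly the vertices joined
-- by an (unoriented) chain of C-arrows, and the arrows x → y of Q' are in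
-- bijection with the K-arrows i → j with f i ≡ x, f j ≡ y.
record IsContraction (m : ℕ) (C K : Fin m → Fin m → Set) (Q' : Quiver) : Set₁ where
  field
    f          : Fin m → Fin (n Q')
    surjective : ∀ x → ∃ λ i → f i ≡ x
    identifies : ∀ i j → f i ≡ f j → EqClosure C i j
    respects   : ∀ i j → EqClosure C i j → f i ≡ f j
    arrows     : ∀ x y → Arr Q' x y ↔ (Σ (Fin m) λ i → Σ (Fin m) λ j →
                                        f i ≡ x × f j ≡ y × K i j)

-- The annulus C_{p,q}, combinatorially via its universal cover.
-- Outer marked points: lifts A ∈ ℤ (projecting to A mod p); inner marked
-- points: lifts B ∈ ℤ (projecting to B mod q); both boundaries oriented
-- counter-clockwise, i.e. lifts increase counter-clockwise.  The deck
-- transformation shifts (A , B) ↦ (A + p , B + q).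

module Annulus (p q : ℕ) .{{_ : NonZero p}} .{{_ : NonZero q}} where

  P Q : ℤ
  P = + p
  Q = + q

  -- Arcs up to isotopy, by canonical representatives:
  --  * bridging a B : the bridging arc whose lift joins outer lift
  --    toℕ a (0 ≤ a < p) to inner lift B ∈ ℤ (all lifts: (a + kp , B + kq));
  --  * outerPeri c d : peripheral arc on ∂ whose lift joins outer lifts
  --    c and c + L, L = 2 + d, i.e. cutting off the piece of ∂ running
  --    counter-clockwise from c, of length 2 ≤ L ≤ p;
  --  * innerPeri e d : same on ∂' (2 ≤ L ≤ q).
  data Arc : Set where
    bridging  : Fin p → ℤ → Arc
    outerPeri : Fin p → Fin (p ∸ 1) → Arc
    innerPeri : Fin q → Fin (q ∸ 1) → Arc

  ι : ∀ {k} → Fin k → ℤ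
  ι a = + toℕ a

  len : ∀ {k} → Fin k → ℤ
  len d = + (2 ℕ.+ toℕ d)

  Interleave : ℤ → ℤ → ℤ → ℤ → Set
  Interleave x x' y y' = (x < y × y < x' × x' < y') ⊎ (y < x × x < y' × y' < x')

  -- Crossing of arcs: some lifts cross in the universal cover.
  Cross : Arc → Arc → Set
  Cross (bridging a b) (bridging a' b') = Σ ℤ λ k →
      (ι a < ι a' + k * P × b' + k * Q < b) ⊎ (ι a' + k * P < ι a × b < b' + k * Q)
  Cross (bridging a b) (outerPeri c d) = Σ ℤ λ k → ι c < ι a + k * P × ι a + k * P < ι c + len d
  Cross (bridging a b) (innerPeri e d) = Σ ℤ λ k → ι e < b + k * Q × b + k * Q < ι e + len d
  Cross (outerPeri c d) (bridging a b) = Σ ℤ λ k → ι c < ι a + k * P × ι a + k * P < ι c + len d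
  Cross (innerPeri e d) (bridging a b) = Σ ℤ λ k → ι e < b + k * Q × b + k * Q < ι e + len d
  Cross (outerPeri c d) (outerPeri c' d') = Σ ℤ λ k →
      Interleave (ι c) (ι c + len d) (ι c' + k * P) (ι c' + k * P + len d')
  Cross (innerPeri e d) (innerPeri e' d') = Σ ℤ λ k →
      Interleave (ι e) (ι e + len d) (ι e' + k * Q) (ι e' + k * Q + len d')
  Cross (outerPeri _ _) (innerPeri _ _) = ⊥
  Cross (innerPeri _ _) (outerPeri _ _) = ⊥

  record IsTriangulation (T : List Arc) : Set where
    field
      distinct    : Unique T
      nonCrossing : ∀ {γ δ} → γ ∈ T → δ ∈ T → ¬ Cross γ δ
      maximal     : ∀ γ → γ ∉ T → Any (Cross γ) T

  IsBridgingArc : Arc → Set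
  IsBridgingArc (bridging _ _) = ⊤
  IsBridgingArc _              = ⊥

  IsBridgingTriangulation : List Arc → Set
  IsBridgingTriangulation T = IsTriangulation T × All IsBridgingArc T

  -- Every triangle of a
  -- bridging triangulation has two arc sides sharing an endpoint and a
  -- boundary segment as third side.  Arrow i → j iff d_i, d_j bound a
  -- common triangle and d_j is the clockwise rotation of d_i about their
  -- common endpoint.  In the plane (boundaries counter-clockwise):
  --  * common endpoint on ∂ (lift A): d_i lifts to (A , B), d_j to
  --    (A , B + 1), third side the segment [B , B+1] of ∂';
  --  * common endpoint on ∂' (lift B): d_i lifts to (A + 1 , B), d_j to
  --    (A , B), third side the segment [A , A+1] of ∂.
  -- We keep the two kinds of arrows apart.

  -- arrow whose arcs share their endpoint on ∂
  OuterStep : Arc → Arc → Set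
  OuterStep (bridging a b) (bridging a' b') = Σ ℤ λ k →
      ι a' + k * P ≡ ι a × b' + k * Q ≡ b + 1ℤ
  OuterStep _ _ = ⊥

  -- arrow whose arcs share their endpoint on ∂'
  InnerStep : Arc → Arc → Set
  InnerStep (bridging a b) (bridging a' b') = Σ ℤ λ k →
      ι a' + k * P + 1ℤ ≡ ι a × b' + k * Q ≡ b
  InnerStep _ _ = ⊥

  OuterArr InnerArr : (T : List Arc) → Fin (length T) → Fin (length T) → Set
  OuterArr T i j = OuterStep (lookup T i) (lookup T j)
  InnerArr T i j = InnerStep (lookup T i) (lookup T j)

  QT : List Arc → Quiver
  QT T = record { n = length T ; Arr = λ i j → OuterArr T i j ⊎ InnerArr T i j }

  -- In the drawing convention of the paper, maximal counter-clockwise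
  -- paths of Q_T are maximal families of consecutive arcs with a common
  -- endpoint on ∂, i.e. paths of OuterArr-arrows; clockwise ones are the
  -- paths of InnerArr-arrows.
  IsQ∂ : List Arc → Quiver → Set₁
  IsQ∂ T Q' = IsContraction (length T) (OuterArr T) (InnerArr T) Q'

  IsQ∂' : List Arc → Quiver → Set₁
  IsQ∂' T Q' = IsContraction (length T) (InnerArr T) (OuterArr T) Q'

  -- Prüfer arcs and D_z^{+∞}(T).
  -- π (inj₁ a) : Prüfer arc starting at outer point a ∈ Fin p,
  -- π (inj₂ b) : Prüfer arc starting at inner point b ∈ Fin q.
  PArc : Set
  PArc = Fin p ⊎ Fin q

  innerPt : ℤ → Fin q
  innerPt b = (b %ℕ q) mod q

  sucP : Fin p → Fin p
  sucP a = ℕ.suc (toℕ a) mod p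

  sucQ : Fin q → Fin q
  sucQ b = ℕ.suc (toℕ b) mod q

  -- a bridging arc [i , j] becomes {π_i , π_j}; (peripheral arcs would
  -- be kept unchanged, but T is bridging in the theorem, so they do not
  -- occur and are not represented here).
  twistLimit : Arc → List PArc
  twistLimit (bridging a b) = inj₁ a ∷ inj₂ (innerPt b) ∷ []
  twistLimit _              = []

  D∞ : List Arc → List PArc
  D∞ T = deduplicate (≡-dec _≟F_ _≟F_) (concatMap twistLimit T)

  -- Its
  -- triangles are: π_a, π_{a+1} and the segment [a , a+1] of ∂; and
  -- π_b, π_{b+1} and the segment [b , b+1] of ∂' (common endpoint: the
  -- asymptotic end on z).  Clockwise rotation about that end gives the
  -- arrows π_{a+1} → π_a (outer side) and π_b → π_{b+1} (inner side).
  PStep : PArc → PArc → Set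
  PStep (inj₁ x) (inj₁ y) = x ≡ sucP y
  PStep (inj₂ x) (inj₂ y) = y ≡ sucQ x
  PStep _        _        = ⊥

  QD : List PArc → Quiver
  QD A = record { n = length A ; Arr = λ i j → PStep (lookup A i) (lookup A j) }

-- Lift to the universal cover ℤ × ℤ: the arcs of a bridging triangulation
-- become a periodic, maximal, non-crossing family of segments (A , B) from
-- an outer lift A to an inner lift B.  The segments at a fixed A form a fan,
-- an interval of inner lifts, and there is exactly one D such that (A , D)
-- and (A + 1 , D) are both segments: the triangle over the boundary segment
-- [A , A + 1].  So contracting the arrows between arcs with a common endpoint
-- on ∂ leaves one vertex per marked point a of ∂ and exactly one remaining
-- arrow from a + 1 to a, as between the Prüfer arcs π_{a+1} and π_a; the
-- inner boundary ∂' is symmetric.  Finally D∞(T) lists every Prüfer arc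
-- exactly once.
module Submission where

open import Defs
open import Data.Nat as ℕ using (ℕ; zero; suc; NonZero)
import Data.Nat.Properties as ℕP
open import Data.Nat.DivMod using (_mod_; _%_; m<n⇒m%n≡m; n%n≡0)
open import Data.Integer as ℤ
  using (ℤ; +_; -[1+_]; _+_; _*_; _-_; -_; _<_; _≤_; 1ℤ; 0ℤ; +<+; +≤+; _%ℕ_; _/ℕ_)
import Data.Integer.Properties as ℤP
open import Data.Integer.DivMod using (n%ℕd<d; a≡a%ℕn+[a/ℕn]*n)
open import Data.Integer.Tactic.RingSolver using (solve-∀)
open import Algebra.Properties.AbelianGroup ℤP.+-0-abelianGroup using (//-rightDividesʳ; \\-leftDividesʳ)
open import Data.Fin as Fin using (Fin; toℕ; fromℕ<; join)
import Data.Fin.Properties as FinP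
open import Data.Product using (Σ; ∃; ∃₂; _×_; _,_; proj₁; proj₂; map₂)
open import Data.Product.Function.NonDependent.Propositional using (_×-↔_)
open import Data.Product.Function.Dependent.Propositional using () renaming (congˡ to Σ-congˡ)
open import Data.Sum using (_⊎_; inj₁; inj₂)
open import Data.Sum.Properties using (≡-dec)
open import Data.Sum.Function.Propositional using (_⊎-↔_)
open import Data.Empty using (⊥; ⊥-elim)
open import Data.List using (List; length; lookup)
import Data.List.Relation.Unary.All as All
open import Data.List.Relation.Unary.Any as Any using (Any; here; there)
open import Data.List.Relation.Unary.Any.Properties using (lookup-index)
open import Data.List.Relation.Unary.AllPairs using (_∷_)
open import Data.List.Relation.Unary.Unique.Propositional using (Unique)
open import Data.List.Relation.Unary.Unique.DecPropositional.Properties using (deduplicate-!)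
open import Data.List.Membership.Propositional using (_∈_; _∉_)
open import Data.List.Membership.Propositional.Properties
  using (∈-lookup; ∈-deduplicate⁺; ∈-concatMap⁺)
open import Function using (flip)
open import Function.Bundles using (_↔_; Inverse; mk↔ₛ′)
open import Function.Properties.Inverse using (↔-refl; ↔-sym; ↔-trans)
open import Function.Related.Propositional using (bijection)
open import Relation.Nullary using (¬_; Dec; yes; no; Irrelevant)
open import Relation.Binary using (tri<; tri≈; tri>)
open import Relation.Binary.PropositionalEquality
import Relation.Binary.Construct.On as On
open import Relation.Binary.Construct.Closure.Equivalence as EqC using (EqClosure)
open import Relation.Binary.Construct.Closure.Symmetric using (SymClosure; fwd; bwd)
open import Relation.Binary.Construct.Closure.ReflexiveTransitive using (ε; _◅_; _◅◅_)
open import Axiom.UniquenessOfIdentityProofs using (module Decidable⇒UIP)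

-- Integers and residues

+-cancelʳ-< : ∀ {i j} k → i + k < j + k → i < j
+-cancelʳ-< {i} {j} k i+k<j+k =
  subst₂ _<_ (//-rightDividesʳ k i) (//-rightDividesʳ k j) (ℤP.+-monoˡ-< (- k) i+k<j+k)

+-cancelˡ-< : ∀ k {i j} → k + i < k + j → i < j
+-cancelˡ-< k {i} {j} k+i<k+j =
  subst₂ _<_ (\\-leftDividesʳ k i) (\\-leftDividesʳ k j) (ℤP.+-monoʳ-< (- k) k+i<k+j)

+-cancelˡ-≤ : ∀ k {i j} → k + i ≤ k + j → i ≤ j
+-cancelˡ-≤ k {i} {j} k+i≤k+j =
  subst₂ _≤_ (\\-leftDividesʳ k i) (\\-leftDividesʳ k j) (ℤP.+-monoʳ-≤ (- k) k+i≤k+j)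

+-cancelʳ-≡ : ∀ i j k → i + k ≡ j + k → i ≡ j
+-cancelʳ-≡ i j k i+k≡j+k =
  trans (sym (//-rightDividesʳ k i)) (trans (cong (_- k) i+k≡j+k) (//-rightDividesʳ k j))

i<i+1 : ∀ i → i < i + 1ℤ
i<i+1 i = ℤP.suc[i]≤j⇒i<j (ℤP.≤-reflexive (ℤP.+-comm 1ℤ i))

i+[1+n]≡i+n+1 : ∀ i n → i + + suc n ≡ i + + n + 1ℤ
i+[1+n]≡i+n+1 i n = sym (trans (ℤP.+-assoc i (+ n) 1ℤ) (cong (λ m → i + + m) (ℕP.+-comm n 1)))

i≤j⇒j≡i+n : ∀ {i j} → i ≤ j → ∃ λ n → j ≡ i + + n
i≤j⇒j≡i+n {i} {j} i≤j = ℤ.∣ j - i ∣ , (begin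
  j               ≡⟨ split i j ⟩
  i + (j - i)     ≡⟨ cong (_+_ i) (sym (ℤP.0≤i⇒+∣i∣≡i (ℤP.i≤j⇒0≤j-i i≤j))) ⟩
  i + + ℤ.∣ j - i ∣ ∎)
  where open ≡-Reasoning
        split : ∀ i j → j ≡ i + (j - i)
        split = solve-∀

greatest-≤ : {P : ℕ → Set} → (∀ t → Dec (P t)) → P 0 → ∀ n →
  ∃ λ m → m ℕ.≤ n × P m × (∀ t → m ℕ.< t → t ℕ.≤ n → ¬ P t)
greatest-≤ P? P0 zero = 0 , ℕ.z≤n , P0 , λ { _ () ℕ.z≤n }
greatest-≤ {P} P? P0 (suc n) with P? (suc n)
... | yes Pn+1 = suc n , ℕP.≤-refl , Pn+1 , λ t n+1<t t≤n+1 _ → ℕP.<⇒≱ n+1<t t≤n+1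
... | no ¬Pn+1 with greatest-≤ P? P0 n
...   | m , m≤n , Pm , above = m , ℕP.m≤n⇒m≤1+n m≤n , Pm , above′
  where
  above′ : ∀ t → m ℕ.< t → t ℕ.≤ suc n → ¬ P t
  above′ t m<t t≤n+1 with ℕP.m≤n⇒m<n∨m≡n t≤n+1
  ... | inj₁ t<n+1 = above t m<t (ℕP.≤-pred t<n+1)
  ... | inj₂ refl  = ¬Pn+1

module Residues (d : ℕ) .{{_ : NonZero d}} where

  D : ℤ
  D = + d

  residue : ℤ → Fin d
  residue x = (x %ℕ d) mod d

  sucᵣ : Fin d → Fin d
  sucᵣ y = suc (toℕ y) mod d

  euclid : ∀ x → x ≡ + (x %ℕ d) + (x /ℕ d) * D
  euclid x = a≡a%ℕn+[a/ℕn]*n x d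

  private
    d≤r : ∀ {r} r' n → + r ≡ + r' + + (suc n ℕ.* d) → d ℕ.≤ r
    d≤r {r} r' n eq = begin
      d                    ≤⟨ ℕP.m≤n*m d (suc n) ⟩
      suc n ℕ.* d          ≤⟨ ℕP.m≤n+m _ r' ⟩
      r' ℕ.+ suc n ℕ.* d   ≡⟨ ℤP.+-injective (trans (ℤP.pos-+ r' _) (sym eq)) ⟩
      r                    ∎
      where open ℕP.≤-Reasoning

    small-multiple≡0 : ∀ {r r'} m → r ℕ.< d → r' ℕ.< d → + r ≡ + r' + m * D → m ≡ 0ℤ
    small-multiple≡0 (+ zero)   _   _    _  = refl
    small-multiple≡0 {r} {r'} (+ suc n) r<d _ eq =
      ⊥-elim (ℕP.<⇒≱ r<d (d≤r r' n (trans eq (cong (_+_ (+ r')) (sym (ℤP.pos-* (suc n) d))))))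
    small-multiple≡0 {r} {r'} -[1+ n ] _ r'<d eq =
      ⊥-elim (ℕP.<⇒≱ r'<d (d≤r r n (begin
        + r'                               ≡⟨ sym (cancel (+ r') (+ suc n) D) ⟩
        + r' + -[1+ n ] * D + + suc n * D  ≡⟨ cong (_+ + suc n * D) (sym eq) ⟩
        + r + + suc n * D                  ≡⟨ cong (_+_ (+ r)) (sym (ℤP.pos-* (suc n) d)) ⟩
        + r + + (suc n ℕ.* d)              ∎)))
      where open ≡-Reasoning
            cancel : ∀ y s e → y + (- s) * e + s * e ≡ y
            cancel = solve-∀

  division-unique : ∀ {r r' k k'} → r ℕ.< d → r' ℕ.< d →
                    + r + k * D ≡ + r' + k' * D → r ≡ r' × k ≡ k'
  division-unique {r} {r'} {k} {k'} r<d r'<d eq = r≡r' , k≡k'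
    where
    move : ∀ x y k k' e → x + k * e ≡ y + k' * e → x ≡ y + (k' - k) * e
    move x y k k' e h = trans (sym (//-rightDividesʳ (k * e) x))
                              (trans (cong (_- k * e) h) (regroup y k k' e))
      where regroup : ∀ y k k' e → y + k' * e - k * e ≡ y + (k' - k) * e
            regroup = solve-∀
    k≡k' : k ≡ k'
    k≡k' = sym (ℤP.i-j≡0⇒i≡j k' k (small-multiple≡0 (k' - k) r<d r'<d (move (+ r) (+ r') k k' D eq)))
    r≡r' : r ≡ r'
    r≡r' = ℤP.+-injective
      (+-cancelʳ-≡ (+ r) (+ r') (k * D) (trans eq (cong (λ z → + r' + z * D) (sym k≡k'))))

  toℕ-residue : ∀ x → toℕ (residue x) ≡ x %ℕ d
  toℕ-residue x = trans (FinP.toℕ-fromℕ< _) (m<n⇒m%n≡m (n%ℕd<d x d))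

  toℕ-residue-unique : ∀ {r k x} → r ℕ.< d → x ≡ + r + k * D → toℕ (residue x) ≡ r
  toℕ-residue-unique {r} {k} {x} r<d x≡ = trans (toℕ-residue x)
    (sym (proj₁ (division-unique {k = k} {k' = x /ℕ d} r<d (n%ℕd<d x d) (trans (sym x≡) (euclid x)))))

  residue-toℕ : ∀ (a : Fin d) → residue (+ toℕ a) ≡ a
  residue-toℕ a = FinP.toℕ-injective
    (toℕ-residue-unique {k = 0ℤ} {x = + toℕ a} (FinP.toℕ<n a) (sym (ℤP.+-identityʳ _)))

  residue-periodic : ∀ x k → residue (x + k * D) ≡ residue x
  residue-periodic x k = FinP.toℕ-injective (trans
    (toℕ-residue-unique {k = x /ℕ d + k} (n%ℕd<d x d)
       (trans (cong (_+ k * D) (euclid x)) (regroup (+ (x %ℕ d)) (x /ℕ d) k D)))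
    (sym (toℕ-residue x)))
    where regroup : ∀ r a k e → r + a * e + k * e ≡ r + (a + k) * e
          regroup = solve-∀

  residue-≡⇒ : ∀ x y → residue x ≡ residue y → ∃ λ k → y + k * D ≡ x
  residue-≡⇒ x y eq = x /ℕ d - y /ℕ d , (begin
    y + (x /ℕ d - y /ℕ d) * D
      ≡⟨ cong (_+ (x /ℕ d - y /ℕ d) * D) (euclid y) ⟩
    + (y %ℕ d) + y /ℕ d * D + (x /ℕ d - y /ℕ d) * D
      ≡⟨ cong (λ r → + r + y /ℕ d * D + (x /ℕ d - y /ℕ d) * D) same-remainder ⟩
    + (x %ℕ d) + y /ℕ d * D + (x /ℕ d - y /ℕ d) * D
      ≡⟨ regroup (+ (x %ℕ d)) (x /ℕ d) (y /ℕ d) D ⟩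
    + (x %ℕ d) + x /ℕ d * D
      ≡⟨ sym (euclid x) ⟩
    x ∎)
    where
    open ≡-Reasoning
    same-remainder : y %ℕ d ≡ x %ℕ d
    same-remainder = trans (sym (toℕ-residue y)) (trans (cong toℕ (sym eq)) (toℕ-residue x))
    regroup : ∀ r a b e → r + b * e + (a - b) * e ≡ r + a * e
    regroup = solve-∀

  toℕ-sucᵣ-residue : ∀ x → toℕ (sucᵣ (residue x)) ≡ suc (x %ℕ d) % d
  toℕ-sucᵣ-residue x = trans (FinP.toℕ-fromℕ< _) (cong (λ r → suc r % d) (toℕ-residue x))

  residue-suc : ∀ x → residue (x + 1ℤ) ≡ sucᵣ (residue x)
  residue-suc x with ℕP.m≤n⇒m<n∨m≡n (n%ℕd<d x d)
  ... | inj₁ r+1<d = FinP.toℕ-injective (begin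
    toℕ (residue (x + 1ℤ))  ≡⟨ toℕ-residue-unique {k = x /ℕ d} r+1<d
                                (trans (cong (_+ 1ℤ) (euclid x)) (regroup (+ (x %ℕ d)) (x /ℕ d) D)) ⟩
    suc (x %ℕ d)            ≡⟨ sym (m<n⇒m%n≡m r+1<d) ⟩
    suc (x %ℕ d) % d        ≡⟨ sym (toℕ-sucᵣ-residue x) ⟩
    toℕ (sucᵣ (residue x))  ∎)
    where open ≡-Reasoning
          regroup : ∀ r a e → r + a * e + 1ℤ ≡ 1ℤ + r + a * e
          regroup = solve-∀
  ... | inj₂ r+1≡d = FinP.toℕ-injective (begin
    toℕ (residue (x + 1ℤ))  ≡⟨ toℕ-residue-unique {k = x /ℕ d + 1ℤ} (ℕ.>-nonZero⁻¹ d) x+1≡ ⟩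
    0                       ≡⟨ sym (n%n≡0 d) ⟩
    d % d                   ≡⟨ cong (_% d) (sym r+1≡d) ⟩
    suc (x %ℕ d) % d        ≡⟨ sym (toℕ-sucᵣ-residue x) ⟩
    toℕ (sucᵣ (residue x))  ∎)
    where
    open ≡-Reasoning
    regroup : ∀ r a e → r + a * e + 1ℤ ≡ 1ℤ + r + a * e
    regroup = solve-∀
    carry : ∀ a e → e + a * e ≡ 0ℤ + (a + 1ℤ) * e
    carry = solve-∀
    x+1≡ : x + 1ℤ ≡ + 0 + (x /ℕ d + 1ℤ) * D
    x+1≡ = begin
      x + 1ℤ                         ≡⟨ cong (_+ 1ℤ) (euclid x) ⟩
      + (x %ℕ d) + x /ℕ d * D + 1ℤ   ≡⟨ regroup (+ (x %ℕ d)) (x /ℕ d) D ⟩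
      + suc (x %ℕ d) + x /ℕ d * D    ≡⟨ cong (λ r → + r + x /ℕ d * D) r+1≡d ⟩
      D + x /ℕ d * D                 ≡⟨ carry (x /ℕ d) D ⟩
      + 0 + (x /ℕ d + 1ℤ) * D        ∎

-- Enumerations and contracted quivers

Fin-≡-irrelevant : ∀ {n} {x y : Fin n} → Irrelevant (x ≡ y)
Fin-≡-irrelevant = Decidable⇒UIP.≡-irrelevant FinP._≟_

irrelevant-↔ : ∀ {A B : Set} → Irrelevant A → Irrelevant B → (A → B) → (B → A) → A ↔ B
irrelevant-↔ A-irr B-irr to from = mk↔ₛ′ to from (λ _ → B-irr _ _) (λ _ → A-irr _ _)

lookup-injective : ∀ {A : Set} {xs : List A} → Unique xs →
                   ∀ i j → lookup xs i ≡ lookup xs j → i ≡ j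
lookup-injective (_ ∷ _)   Fin.zero    Fin.zero    _  = refl
lookup-injective (x∉ ∷ _)  Fin.zero    (Fin.suc j) eq = ⊥-elim (All.lookup x∉ (∈-lookup j) eq)
lookup-injective (x∉ ∷ _)  (Fin.suc i) Fin.zero    eq = ⊥-elim (All.lookup x∉ (∈-lookup i) (sym eq))
lookup-injective (_ ∷ xs!) (Fin.suc i) (Fin.suc j) eq = cong Fin.suc (lookup-injective xs! i j eq)

enumeration-↔ : ∀ {A : Set} {xs : List A} → Unique xs → (∀ x → x ∈ xs) → Fin (length xs) ↔ A
enumeration-↔ {xs = xs} xs! enum = mk↔ₛ′ (lookup xs) (λ x → Any.index (enum x))
  (λ x → sym (lookup-index (enum x)))
  (λ i → lookup-injective xs! _ i (sym (lookup-index (enum (lookup xs i)))))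

module Contraction {m} {C K : Fin m → Fin m → Set} {Q' : Quiver} (c : IsContraction m C K Q')
  {k} (cls : Fin m → Fin k) (cls-onto : ∀ x → ∃ λ i → cls i ≡ x)
  (cls-respects : ∀ {i j} → C i j → cls i ≡ cls j)
  (cls-identifies : ∀ {i j} → cls i ≡ cls j → EqClosure C i j) where

  open IsContraction c

  vertex : Fin k → Fin (n Q')
  vertex x = f (proj₁ (cls-onto x))

  f≡⇒cls≡ : ∀ {i j} → f i ≡ f j → cls i ≡ cls j
  f≡⇒cls≡ {i} {j} eq = EqC.fold (On.isEquivalence cls isEquivalence) cls-respects (identifies i j eq)

  cls≡⇒f≡ : ∀ {i j} → cls i ≡ cls j → f i ≡ f j
  cls≡⇒f≡ {i} {j} eq = respects i j (cls-identifies eq)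

  f≡vertex-↔ : ∀ i x → (f i ≡ vertex x) ↔ (cls i ≡ x)
  f≡vertex-↔ i x = irrelevant-↔ Fin-≡-irrelevant Fin-≡-irrelevant
    (λ eq → trans (f≡⇒cls≡ eq) (proj₂ (cls-onto x)))
    (λ eq → cls≡⇒f≡ (trans eq (sym (proj₂ (cls-onto x)))))

  vertex-↔ : Fin k ↔ Fin (n Q')
  vertex-↔ = mk↔ₛ′ vertex (λ v → cls (proj₁ (surjective v)))
    (λ v → trans (cls≡⇒f≡ (proj₂ (cls-onto _))) (proj₂ (surjective v)))
    (λ x → Inverse.to (f≡vertex-↔ _ x) (proj₂ (surjective (vertex x))))

  vertex-arrows : ∀ x y → Arr Q' (vertex x) (vertex y) ↔
                  (Σ (Fin m) λ i → Σ (Fin m) λ j → cls i ≡ x × cls j ≡ y × K i j)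
  vertex-arrows x y = ↔-trans (arrows (vertex x) (vertex y))
    (Σ-congˡ {k = bijection} λ {i} → Σ-congˡ {k = bijection} λ {j} →
      f≡vertex-↔ i x ×-↔ f≡vertex-↔ j y ×-↔ ↔-refl)

⊔Q-arrows : ∀ Q₁ Q₂ x y →
            ⊔Arr (Arr Q₁) (Arr Q₂) x y ↔ Arr (Q₁ ⊔Q Q₂) (join (n Q₁) (n Q₂) x) (join (n Q₁) (n Q₂) y)
⊔Q-arrows Q₁ Q₂ x y = subst₂ (λ u v → ⊔Arr (Arr Q₁) (Arr Q₂) x y ↔ ⊔Arr (Arr Q₁) (Arr Q₂) u v)
  (sym (FinP.splitAt-join (n Q₁) (n Q₂) x)) (sym (FinP.splitAt-join (n Q₁) (n Q₂) y)) ↔-refl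

-- Periodic non-crossing families of segments

-- S A B: the segment of the universal cover from the outer lift A to the
-- inner lift B is a lift of an arc; deck transformations shift by (p , q).
Crosses : ℤ → ℤ → ℤ → ℤ → Set
Crosses A B C D = (A < C × D < B) ⊎ (C < A × B < D)

Crosses-transpose : ∀ {A B C D} → Crosses A B C D → Crosses B A D C
Crosses-transpose (inj₁ (A<C , D<B)) = inj₂ (D<B , A<C)
Crosses-transpose (inj₂ (C<A , B<D)) = inj₁ (B<D , C<A)

record IsLiftedTriangulation (p q : ℕ) (S : ℤ → ℤ → Set) : Set where
  field
    decidable   : ∀ A B → Dec (S A B)
    periodic    : ∀ k {A B} → S A B → S (A + k * + p) (B + k * + q)
    nonCrossing : ∀ {A B C D} → S A B → S C D → ¬ Crosses A B C D
    maximal     : ∀ A B → (∀ {C D} → S C D → ¬ Crosses A B C D) → S A B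
    nonEmpty    : ∃₂ S

transpose : ∀ {p q S} → IsLiftedTriangulation p q S → IsLiftedTriangulation q p (flip S)
transpose isLT = record
  { decidable   = flip decidable
  ; periodic    = λ k → periodic k
  ; nonCrossing = λ sAB sCD cr → nonCrossing sAB sCD (Crosses-transpose cr)
  ; maximal     = λ B A ok → maximal A B (λ sCD cr → ok sCD (Crosses-transpose cr))
  ; nonEmpty    = let A , B , sAB = nonEmpty in B , A , sAB
  }
  where open IsLiftedTriangulation isLT

module LiftedTriangulation {p q : ℕ} .{{_ : NonZero p}} {S : ℤ → ℤ → Set}
                           (isLT : IsLiftedTriangulation p q S) where

  open IsLiftedTriangulation isLT

  next-period : ∀ {A B} → S A B → S (A + + p) (B + + q)
  next-period {A} {B} sAB =
    subst₂ S (cong (_+_ A) (ℤP.*-identityˡ (+ p))) (cong (_+_ B) (ℤP.*-identityˡ (+ q)))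
             (periodic 1ℤ sAB)

  fan-convex : ∀ {A B B' Y} → S A B → S A B' → B ≤ Y → Y ≤ B' → S A Y
  fan-convex {A} {B} {B'} {Y} sAB sAB' B≤Y Y≤B' = maximal A Y λ where
    sCD (inj₁ (A<C , D<Y)) → nonCrossing sAB' sCD (inj₁ (A<C , ℤP.<-≤-trans D<Y Y≤B'))
    sCD (inj₂ (C<A , Y<D)) → nonCrossing sAB  sCD (inj₂ (C<A , ℤP.≤-<-trans B≤Y Y<D))

  fan-width : ∀ {A B B'} → S A B → S A B' → B' ≤ B + + q
  fan-width {A} sAB sAB' = ℤP.≮⇒≥ λ B+q<B' →
    nonCrossing (next-period sAB) sAB' (inj₂ (A<A+p , B+q<B'))
    where A<A+p : A < A + + p
          A<A+p = subst (_< A + + p) (ℤP.+-identityʳ A) (ℤP.+-monoʳ-< A (+<+ (ℕ.>-nonZero⁻¹ p)))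

  apex-unique : ∀ {A B B'} → S A B → S (A + 1ℤ) B → S A B' → S (A + 1ℤ) B' → B ≡ B'
  apex-unique {A} {B} {B'} sAB sA+1B sAB' sA+1B' with ℤP.<-cmp B B'
  ... | tri< B<B' _ _ = ⊥-elim (nonCrossing sAB' sA+1B (inj₁ (i<i+1 A , B<B')))
  ... | tri≈ _ B≡B' _ = B≡B'
  ... | tri> _ _ B'<B = ⊥-elim (nonCrossing sAB sA+1B' (inj₁ (i<i+1 A , B'<B)))

  -- The top D of the fan at A is at most q above B, and no segment crosses (A + 1 , D).
  apex : ∀ {A B} → S A B → ∃ λ D → S A D × S (A + 1ℤ) D
  apex {A} {B} sAB
    with greatest-≤ (λ t → decidable A (B + + t)) (subst (S A) (sym (ℤP.+-identityʳ B)) sAB) q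
  ... | m , _ , sAD , maximum = B + + m , sAD , maximal (A + 1ℤ) (B + + m) no-crossing
    where
    above-top : ∀ {E} → S A E → B + + m < E → ⊥
    above-top {E} sAE D<E with i≤j⇒j≡i+n (ℤP.<⇒≤ (ℤP.≤-<-trans (ℤP.i≤i+j B (+ m)) D<E))
    ... | t , E≡B+t = maximum t m<t t≤q (subst (S A) E≡B+t sAE)
      where
      m<t : m ℕ.< t
      m<t = ℤP.drop‿+<+ (+-cancelˡ-< B (subst (B + + m <_) E≡B+t D<E))
      t≤q : t ℕ.≤ q
      t≤q = ℤP.drop‿+≤+ (+-cancelˡ-≤ B (subst (_≤ B + + q) E≡B+t (fan-width sAB sAE)))
    no-crossing : ∀ {C E} → S C E → ¬ Crosses (A + 1ℤ) (B + + m) C E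
    no-crossing sCE (inj₁ (A+1<C , E<D)) = nonCrossing sAD sCE (inj₁ (ℤP.<-trans (i<i+1 A) A+1<C , E<D))
    no-crossing {C} sCE (inj₂ (C<A+1 , D<E)) with ℤP.<-cmp C A
    ... | tri< C<A _ _ = nonCrossing sAB sCE (inj₂ (C<A , ℤP.≤-<-trans (ℤP.i≤i+j B (+ m)) D<E))
    ... | tri≈ _ refl _ = above-top sCE D<E
    ... | tri> _ _ A<C = ℤP.<-irrefl refl
          (ℤP.<-≤-trans C<A+1 (subst (_≤ C) (ℤP.+-comm 1ℤ A) (ℤP.i<j⇒suc[i]≤j A<C)))

  lift-after : ∀ {A B} → S A B → ∀ r → ∃ (S (A + + r))
  lift-after {A} {B} sAB zero = B , subst (λ A' → S A' B) (sym (ℤP.+-identityʳ A)) sAB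
  lift-after {A} sAB (suc r) with apex (proj₂ (lift-after sAB r))
  ... | D , _ , sA+r+1D = D , subst (λ A' → S A' D) (sym (i+[1+n]≡i+n+1 A r)) sA+r+1D

  lift-at : ∀ A → ∃ (S A)
  lift-at A = let A₀ , B₀ , sA₀B₀ = nonEmpty
                  r = (A - A₀) %ℕ p
                  k = (A - A₀) /ℕ p
              in map₂ (subst (λ A' → S A' _) (lifted-base A₀)) (lift-after (periodic k sA₀B₀) r)
    where
    open ≡-Reasoning
    regroup : ∀ a₀ r k e → a₀ + k * e + r ≡ a₀ + (r + k * e)
    regroup = solve-∀
    telescope : ∀ a₀ a → a₀ + (a - a₀) ≡ a
    telescope = solve-∀
    lifted-base : ∀ A₀ → A₀ + (A - A₀) /ℕ p * + p + + ((A - A₀) %ℕ p) ≡ A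
    lifted-base A₀ = begin
      A₀ + (A - A₀) /ℕ p * + p + + ((A - A₀) %ℕ p)
        ≡⟨ regroup A₀ (+ ((A - A₀) %ℕ p)) ((A - A₀) /ℕ p) (+ p) ⟩
      A₀ + (+ ((A - A₀) %ℕ p) + (A - A₀) /ℕ p * + p)
        ≡⟨ cong (_+_ A₀) (sym (a≡a%ℕn+[a/ℕn]*n (A - A₀) p)) ⟩
      A₀ + (A - A₀)
        ≡⟨ telescope A₀ A ⟩
      A ∎

  triangle : ∀ A → ∃ λ D → S A D × S (A + 1ℤ) D
  triangle A = apex (proj₂ (lift-at A))

-- Lifts of arcs of the annulus

module Lifts (p q : ℕ) .{{_ : NonZero p}} .{{_ : NonZero q}} where

  open Annulus p q
  module Rp = Residues p
  module Rq = Residues q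

  IsLift : Arc → ℤ → ℤ → Set
  IsLift (bridging a b) A B = ∃ λ k → ι a + k * P ≡ A × b + k * Q ≡ B
  IsLift _              _ _ = ⊥

  innerLift : Arc → ℤ
  innerLift (bridging _ b) = b
  innerLift _              = 0ℤ

  -- junk value on peripheral arcs, which a bridging triangulation does not contain
  outerEnd : Arc → Fin p
  outerEnd (bridging a _) = a
  outerEnd _              = 0 mod p

  innerEnd : Arc → Fin q
  innerEnd γ = innerPt (innerLift γ)

  private
    shift : ∀ x k k' e → x + k * e + k' * e ≡ x + (k + k') * e
    shift = solve-∀
    unshift : ∀ x k k' e → x + (k' - k) * e + k * e ≡ x + k' * e
    unshift = solve-∀
    no-shift : ∀ x e → x + 0ℤ * e ≡ x
    no-shift = solve-∀

  base-lift : ∀ γ → IsBridgingArc γ → IsLift γ (ι (outerEnd γ)) (innerLift γ)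
  base-lift (bridging a b) _ = 0ℤ , no-shift (ι a) P , no-shift b Q

  IsLift-periodic : ∀ γ {A B} k → IsLift γ A B → IsLift γ (A + k * P) (B + k * Q)
  IsLift-periodic (bridging a b) k (k₀ , refl , refl) =
    k₀ + k , sym (shift (ι a) k₀ k P) , sym (shift b k₀ k Q)

  IsLift-injective : ∀ γ δ {A B} → IsLift γ A B → IsLift δ A B → γ ≡ δ
  IsLift-injective (bridging a b) (bridging a' b') (k , refl , refl) (k' , eA , eB)
    with Rp.division-unique {k = k} {k' = k'} (FinP.toℕ<n a) (FinP.toℕ<n a') (sym eA)
  ... | toℕa≡toℕa' , refl =
    cong₂ bridging (FinP.toℕ-injective toℕa≡toℕa') (+-cancelʳ-≡ b b' (k * Q) (sym eB))

  IsLift⇒outerEnd : ∀ γ {A B} → IsLift γ A B → outerEnd γ ≡ Rp.residue A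
  IsLift⇒outerEnd (bridging a b) (k , refl , _) =
    sym (trans (Rp.residue-periodic (ι a) k) (Rp.residue-toℕ a))

  IsLift⇒innerEnd : ∀ γ {A B} → IsLift γ A B → innerEnd γ ≡ Rq.residue B
  IsLift⇒innerEnd (bridging a b) (k , _ , refl) = sym (Rq.residue-periodic b k)

  canonical : ℤ → ℤ → Arc
  canonical A B = bridging (fromℕ< (n%ℕd<d A p)) (B - A /ℕ p * Q)

  canonical-IsLift : ∀ A B → IsLift (canonical A B) A B
  canonical-IsLift A B = A /ℕ p ,
    trans (cong (λ r → + r + A /ℕ p * P) (FinP.toℕ-fromℕ< (n%ℕd<d A p))) (sym (Rp.euclid A)) ,
    cancel B (A /ℕ p * Q)
    where cancel : ∀ y z → y - z + z ≡ y
          cancel = solve-∀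

  IsLift⇒canonical : ∀ γ {A B} → IsLift γ A B → canonical A B ≡ γ
  IsLift⇒canonical γ {A} {B} = IsLift-injective (canonical A B) γ (canonical-IsLift A B)

  IsLift? : ∀ γ A B → Dec (IsLift γ A B)
  IsLift? (bridging a b) A B with fromℕ< (n%ℕd<d A p) FinP.≟ a | B - A /ℕ p * Q ℤP.≟ b
  ... | yes refl | yes refl = yes (canonical-IsLift A B)
  ... | no a₀≢a  | _        = no λ l → a₀≢a (cong outerEnd  (IsLift⇒canonical (bridging a b) l))
  ... | _        | no b₀≢b  = no λ l → b₀≢b (cong innerLift (IsLift⇒canonical (bridging a b) l))
  IsLift? (outerPeri _ _) _ _ = no λ ()
  IsLift? (innerPeri _ _) _ _ = no λ ()

  private
    raise : ∀ {x} y k k' e → x < y + k' * e → x + k * e < y + (k' + k) * e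
    raise {x} y k k' e x<y = subst (x + k * e <_) (shift y k' k e) (ℤP.+-monoˡ-< (k * e) x<y)
    raiseᵣ : ∀ {x} y k k' e → y + k' * e < x → y + (k' + k) * e < x + k * e
    raiseᵣ {x} y k k' e y<x = subst (_< x + k * e) (shift y k' k e) (ℤP.+-monoˡ-< (k * e) y<x)
    lower : ∀ {x} y k k' e → x + k * e < y + k' * e → x < y + (k' - k) * e
    lower {x} y k k' e lt = +-cancelʳ-< (k * e) (subst (x + k * e <_) (sym (unshift y k k' e)) lt)
    lowerᵣ : ∀ {x} y k k' e → y + k' * e < x + k * e → y + (k' - k) * e < x
    lowerᵣ {x} y k k' e lt = +-cancelʳ-< (k * e) (subst (_< x + k * e) (sym (unshift y k k' e)) lt)

  Crosses⇒Cross : ∀ γ δ {A B C D} → IsLift γ A B → IsLift δ C D → Crosses A B C D → Cross γ δ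
  Crosses⇒Cross (bridging a b) (bridging a' b') (k , refl , refl) (k' , refl , refl) (inj₁ (A<C , D<B)) =
    k' - k , inj₁ (lower (ι a') k k' P A<C , lowerᵣ b' k k' Q D<B)
  Crosses⇒Cross (bridging a b) (bridging a' b') (k , refl , refl) (k' , refl , refl) (inj₂ (C<A , B<D)) =
    k' - k , inj₂ (lowerᵣ (ι a') k k' P C<A , lower b' k k' Q B<D)

  Cross⇒Crosses : ∀ γ δ {A B} → IsLift γ A B → IsBridgingArc δ → Cross γ δ →
                  ∃₂ λ C D → IsLift δ C D × Crosses A B C D
  Cross⇒Crosses (bridging a b) (bridging a' b') (k , refl , refl) _ (k' , crosses) =
    ι a' + (k' + k) * P , b' + (k' + k) * Q , (k' + k , refl , refl) , lift-crossing crosses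
    where
    lift-crossing : _ → Crosses (ι a + k * P) (b + k * Q) (ι a' + (k' + k) * P) (b' + (k' + k) * Q)
    lift-crossing (inj₁ (a<c , d<b)) = inj₁ (raise (ι a') k k' P a<c , raiseᵣ b' k k' Q d<b)
    lift-crossing (inj₂ (c<a , b<d)) = inj₂ (raiseᵣ (ι a') k k' P c<a , raise b' k k' Q b<d)

  private
    swap-1 : ∀ x y → x + y + 1ℤ ≡ x + 1ℤ + y
    swap-1 = solve-∀

  OuterStep⇒IsLift : ∀ γ δ {A B} → OuterStep γ δ → IsLift γ A B → IsLift δ A (B + 1ℤ)
  OuterStep⇒IsLift (bridging a b) (bridging a' b') (k , a'≡a , b'≡b+1) (k₀ , refl , refl) =
    k + k₀ , trans (sym (shift (ι a') k k₀ P)) (cong (_+ k₀ * P) a'≡a) ,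
             trans (sym (shift b' k k₀ Q)) (trans (cong (_+ k₀ * Q) b'≡b+1) (sym (swap-1 b (k₀ * Q))))

  IsLift⇒OuterStep : ∀ γ δ {A B} → IsLift γ A B → IsLift δ A (B + 1ℤ) → OuterStep γ δ
  IsLift⇒OuterStep (bridging a b) (bridging a' b') (k , refl , refl) (k' , eA , eB) =
    k' - k , +-cancelʳ-≡ _ _ (k * P) (trans (unshift (ι a') k k' P) eA) ,
             +-cancelʳ-≡ _ _ (k * Q) (trans (unshift b' k k' Q) (trans eB (swap-1 b (k * Q))))

  InnerStep⇒IsLift : ∀ γ δ {A B} → InnerStep γ δ → IsLift δ A B → IsLift γ (A + 1ℤ) B
  InnerStep⇒IsLift (bridging a b) (bridging a' b') (k , a'+1≡a , b'≡b) (k₀ , refl , refl) =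
    k₀ - k , trans (cong (_+ (k₀ - k) * P) (sym a'+1≡a)) (rebase₁ (ι a') k k₀ P) ,
             trans (cong (_+ (k₀ - k) * Q) (sym b'≡b)) (rebase b' k k₀ Q)
    where rebase₁ : ∀ x k k₀ e → x + k * e + 1ℤ + (k₀ - k) * e ≡ x + k₀ * e + 1ℤ
          rebase₁ = solve-∀
          rebase : ∀ x k k₀ e → x + k * e + (k₀ - k) * e ≡ x + k₀ * e
          rebase = solve-∀

  IsLift⇒InnerStep : ∀ γ δ {A B} → IsLift γ (A + 1ℤ) B → IsLift δ A B → InnerStep γ δ
  IsLift⇒InnerStep (bridging a b) (bridging a' b') (k , eA , eB) (k' , refl , refl) =
    k' - k , +-cancelʳ-≡ _ _ (k * P) (trans (outer (ι a') k k' P) (sym eA)) ,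
             +-cancelʳ-≡ _ _ (k * Q) (trans (unshift b' k k' Q) (sym eB))
    where outer : ∀ x k k' e → x + (k' - k) * e + 1ℤ + k * e ≡ x + k' * e + 1ℤ
          outer = solve-∀

  OuterStep-outerEnd : ∀ γ δ → OuterStep γ δ → outerEnd γ ≡ outerEnd δ
  OuterStep-outerEnd γ@(bridging _ _) δ@(bridging _ _) s =
    sym (trans (IsLift⇒outerEnd δ (OuterStep⇒IsLift γ δ s (base-lift γ _))) (Rp.residue-toℕ (outerEnd γ)))

  OuterStep-innerEnd : ∀ γ δ → OuterStep γ δ → innerEnd δ ≡ sucQ (innerEnd γ)
  OuterStep-innerEnd γ@(bridging _ _) δ@(bridging _ _) s =
    trans (IsLift⇒innerEnd δ (OuterStep⇒IsLift γ δ s (base-lift γ _))) (Rq.residue-suc (innerLift γ))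

  InnerStep-innerEnd : ∀ γ δ → InnerStep γ δ → innerEnd γ ≡ innerEnd δ
  InnerStep-innerEnd γ@(bridging _ _) δ@(bridging _ _) s =
    IsLift⇒innerEnd γ (InnerStep⇒IsLift γ δ s (base-lift δ _))

  InnerStep-outerEnd : ∀ γ δ → InnerStep γ δ → outerEnd γ ≡ sucP (outerEnd δ)
  InnerStep-outerEnd γ@(bridging _ _) δ@(bridging _ _) s =
    trans (IsLift⇒outerEnd γ (InnerStep⇒IsLift γ δ s (base-lift δ _)))
          (trans (Rp.residue-suc (ι (outerEnd δ))) (cong sucP (Rp.residue-toℕ (outerEnd δ))))

  private
    ℤ-≡-irrelevant : ∀ {x y : ℤ} → Irrelevant (x ≡ y)
    ℤ-≡-irrelevant = Decidable⇒UIP.≡-irrelevant ℤP._≟_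

  OuterStep-irrelevant : ∀ γ δ → Irrelevant (OuterStep γ δ)
  OuterStep-irrelevant (bridging a b) (bridging a' b') (k , ea , eb) (k' , ea' , eb')
    with Rp.division-unique {k = k} {k' = k'} (FinP.toℕ<n a') (FinP.toℕ<n a') (trans ea (sym ea'))
  ... | _ , refl = cong₂ (λ ea eb → k , ea , eb) (ℤ-≡-irrelevant ea ea') (ℤ-≡-irrelevant eb eb')

  InnerStep-irrelevant : ∀ γ δ → Irrelevant (InnerStep γ δ)
  InnerStep-irrelevant (bridging a b) (bridging a' b') (k , ea , eb) (k' , ea' , eb')
    with Rp.division-unique {k = k} {k' = k'} (FinP.toℕ<n a') (FinP.toℕ<n a')
           (+-cancelʳ-≡ _ _ 1ℤ (trans ea (sym ea')))
  ... | _ , refl = cong₂ (λ ea eb → k , ea , eb) (ℤ-≡-irrelevant ea ea') (ℤ-≡-irrelevant eb eb')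

-- Fans and triangles of a bridging triangulation

module _ {I : Set} (R : I → I → Set) (L : ℤ → I → Set)
  (L-functional : ∀ {Y i j} → L Y i → L Y j → i ≡ j)
  (L-step : ∀ {Y i j} → L Y i → L (Y + 1ℤ) j → SymClosure R i j)
  (L-convex : ∀ {Y Y' Z i j} → L Y i → L Y' j → Y ≤ Z → Z ≤ Y' → ∃ (L Z)) where

  private
    climb : ∀ n {Y i j} → L Y i → L (Y + + n) j → EqClosure R i j
    climb zero {Y} li lj with L-functional li (subst (λ Z → L Z _) (ℤP.+-identityʳ Y) lj)
    ... | refl = ε
    climb (suc n) {Y} li lj with L-convex li lj (ℤP.i≤i+j Y (+ n)) (ℤP.+-monoʳ-≤ Y (+≤+ (ℕP.n≤1+n n)))
    ... | _ , lm = climb n li lm ◅◅ (L-step lm (subst (λ Z → L Z _) (i+[1+n]≡i+n+1 Y n) lj) ◅ ε)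

  ladder-connected : ∀ {Y Y' i j} → L Y i → L Y' j → EqClosure R i j
  ladder-connected {Y} {Y'} li lj with ℤP.≤-total Y Y'
  ... | inj₁ Y≤Y' = let n , Y'≡Y+n = i≤j⇒j≡i+n Y≤Y' in
    climb n li (subst (λ Z → L Z _) Y'≡Y+n lj)
  ... | inj₂ Y'≤Y = let n , Y≡Y'+n = i≤j⇒j≡i+n Y'≤Y in
    EqC.symmetric R (climb n lj (subst (λ Z → L Z _) Y≡Y'+n li))

module BridgingTriangulation (p q : ℕ) .{{_ : NonZero p}} .{{_ : NonZero q}}
  (T : List (Annulus.Arc p q)) (bt : Annulus.IsBridgingTriangulation p q T) where

  open Annulus p q
  open Lifts p q
  open IsTriangulation (proj₁ bt)

  N : ℕ
  N = length T

  arc : Fin N → Arc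
  arc = lookup T

  arc-bridging : ∀ i → IsBridgingArc (arc i)
  arc-bridging i = All.lookup (proj₂ bt) (∈-lookup i)

  LiftOf : ℤ → ℤ → Fin N → Set
  LiftOf A B i = IsLift (arc i) A B

  Lifted : ℤ → ℤ → Set
  Lifted A B = ∃ (LiftOf A B)

  LiftOf-functional : ∀ {A B i j} → LiftOf A B i → LiftOf A B j → i ≡ j
  LiftOf-functional {i = i} {j} li lj = lookup-injective distinct i j (IsLift-injective (arc i) (arc j) li lj)

  outer : Fin N → Fin p
  outer i = outerEnd (arc i)

  inner : Fin N → Fin q
  inner i = innerEnd (arc i)

  base : ∀ i → LiftOf (ι (outer i)) (innerLift (arc i)) i
  base i = base-lift (arc i) (arc-bridging i)

  private
    Lifted? : ∀ A B → Dec (Lifted A B)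
    Lifted? A B = FinP.any? λ i → IsLift? (arc i) A B

    canonical-crossed : ∀ A B → ¬ Lifted A B → ∃ λ j → Cross (canonical A B) (arc j)
    canonical-crossed A B ¬lifted = Any.index crossing , lookup-index crossing
      where
      canonical∉T : canonical A B ∉ T
      canonical∉T γ∈T = ¬lifted (Any.index γ∈T ,
        subst (λ γ → IsLift γ A B) (lookup-index γ∈T) (canonical-IsLift A B))
      crossing = maximal (canonical A B) canonical∉T

    maximal-lifts : ∀ A B → (∀ {C D} → Lifted C D → ¬ Crosses A B C D) → Lifted A B
    maximal-lifts A B uncrossed with Lifted? A B
    ... | yes lifted = lifted
    ... | no ¬lifted with canonical-crossed A B ¬lifted
    ...   | j , cross with Cross⇒Crosses (canonical A B) (arc j) (canonical-IsLift A B) (arc-bridging j) cross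
    ...     | _ , _ , lj , crosses = ⊥-elim (uncrossed (j , lj) crosses)

    some-lift : ∃₂ Lifted
    some-lift with Lifted? 0ℤ 0ℤ
    ... | yes lifted = 0ℤ , 0ℤ , lifted
    ... | no ¬lifted = let j , _ = canonical-crossed 0ℤ 0ℤ ¬lifted in _ , _ , j , base j

  lifted-triangulation : IsLiftedTriangulation p q Lifted
  lifted-triangulation = record
    { decidable   = Lifted?
    ; periodic    = λ k (i , li) → i , IsLift-periodic (arc i) k li
    ; nonCrossing = λ (i , li) (j , lj) crosses →
        nonCrossing (∈-lookup i) (∈-lookup j) (Crosses⇒Cross (arc i) (arc j) li lj crosses)
    ; maximal     = maximal-lifts
    ; nonEmpty    = some-lift
    }

  module Outer = LiftedTriangulation lifted-triangulation
  module Inner = LiftedTriangulation (transpose lifted-triangulation)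

  outer-respects : ∀ {i j} → OuterArr T i j → outer i ≡ outer j
  outer-respects = OuterStep-outerEnd _ _

  inner-respects : ∀ {i j} → InnerArr T i j → inner i ≡ inner j
  inner-respects = InnerStep-innerEnd _ _

  outer-identifies : ∀ {i j} → outer i ≡ outer j → EqClosure (OuterArr T) i j
  outer-identifies {i} {j} oi≡oj =
    ladder-connected (OuterArr T) (LiftOf (ι (outer i))) LiftOf-functional
      (λ lm lm' → fwd (IsLift⇒OuterStep _ _ lm lm'))
      (λ lm lm' → Outer.fan-convex (_ , lm) (_ , lm'))
      (base i) (subst (λ a → LiftOf (ι a) (innerLift (arc j)) j) (sym oi≡oj) (base j))

  inner-identifies : ∀ {i j} → inner i ≡ inner j → EqClosure (InnerArr T) i j
  inner-identifies {i} {j} ii≡ij with Rq.residue-≡⇒ (innerLift (arc i)) (innerLift (arc j)) ii≡ij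
  ... | k , shifted-j =
    ladder-connected (InnerArr T) (λ A → LiftOf A (innerLift (arc i))) LiftOf-functional
      (λ lm lm' → bwd (IsLift⇒InnerStep _ _ lm' lm))
      (λ lm lm' → Inner.fan-convex (_ , lm) (_ , lm'))
      (base i) (subst (λ B → LiftOf (ι (outer j) + k * P) B j) shifted-j (IsLift-periodic (arc j) k (base j)))

  outer-onto : ∀ a → ∃ λ i → outer i ≡ a
  outer-onto a = let _ , i , li = Outer.lift-at (ι a) in
    i , trans (IsLift⇒outerEnd (arc i) li) (Rp.residue-toℕ a)

  inner-onto : ∀ b → ∃ λ i → inner i ≡ b
  inner-onto b = let _ , i , li = Inner.lift-at (ι b) in
    i , trans (IsLift⇒innerEnd (arc i) li) (Rq.residue-toℕ b)

  outer-triangle : ∀ a → ∃₂ λ i j → outer i ≡ sucP a × outer j ≡ a × InnerArr T i j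
  outer-triangle a with Outer.triangle (ι a)
  ... | _ , (j , lj) , (i , li) = i , j , trans (InnerStep-outerEnd _ _ ij) (cong sucP oj≡a) , oj≡a , ij
    where ij = IsLift⇒InnerStep (arc i) (arc j) li lj
          oj≡a = trans (IsLift⇒outerEnd (arc j) lj) (Rp.residue-toℕ a)

  inner-triangle : ∀ b → ∃₂ λ i j → inner i ≡ b × inner j ≡ sucQ b × OuterArr T i j
  inner-triangle b with Inner.triangle (ι b)
  ... | _ , (i , li) , (j , lj) = i , j , ii≡b , trans (OuterStep-innerEnd _ _ ij) (cong sucQ ii≡b) , ij
    where ij = IsLift⇒OuterStep (arc i) (arc j) li lj
          ii≡b = trans (IsLift⇒innerEnd (arc i) li) (Rq.residue-toℕ b)

  outer-triangle-unique : ∀ {i j i' j'} → InnerArr T i j → InnerArr T i' j' → outer j ≡ outer j' →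
                          i ≡ i' × j ≡ j'
  outer-triangle-unique {i} {j} {i'} {j'} ij i'j' oj≡oj' =
    LiftOf-functional li (subst (λ B → LiftOf _ B i') (sym B≡B') li') ,
    LiftOf-functional lj (subst (λ B → LiftOf _ B j') (sym B≡B') lj')
    where
    A = ι (outer j)
    B = innerLift (arc j)
    B' = innerLift (arc j')
    lj : LiftOf A B j
    lj = base j
    li : LiftOf (A + 1ℤ) B i
    li = InnerStep⇒IsLift (arc i) (arc j) ij lj
    lj' : LiftOf A B' j'
    lj' = subst (λ a → LiftOf (ι a) B' j') (sym oj≡oj') (base j')
    li' : LiftOf (A + 1ℤ) B' i'
    li' = InnerStep⇒IsLift (arc i') (arc j') i'j' lj'
    B≡B' : B ≡ B'
    B≡B' = Outer.apex-unique (j , lj) (i , li) (j' , lj') (i' , li')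

  inner-triangle-unique : ∀ {i j i' j'} → OuterArr T i j → OuterArr T i' j' → inner i ≡ inner i' →
                          i ≡ i' × j ≡ j'
  inner-triangle-unique {i} {j} {i'} {j'} ij i'j' ii≡ii'
    with Rq.residue-≡⇒ (innerLift (arc i)) (innerLift (arc i')) ii≡ii'
  ... | k , shifted-i' =
    LiftOf-functional li (subst (λ A → LiftOf A _ i') (sym A≡A') li') ,
    LiftOf-functional lj (subst (λ A → LiftOf A _ j') (sym A≡A') lj')
    where
    A = ι (outer i)
    A' = ι (outer i') + k * P
    B = innerLift (arc i)
    li : LiftOf A B i
    li = base i
    lj : LiftOf A (B + 1ℤ) j
    lj = OuterStep⇒IsLift (arc i) (arc j) ij li
    li' : LiftOf A' B i'
    li' = subst (λ B → LiftOf A' B i') shifted-i' (IsLift-periodic (arc i') k (base i'))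
    lj' : LiftOf A' (B + 1ℤ) j'
    lj' = OuterStep⇒IsLift (arc i') (arc j') i'j' li'
    A≡A' : A ≡ A'
    A≡A' = Inner.apex-unique (i , li) (j , lj) (i' , li') (j' , lj')

  InnerArr-between-fans : ∀ a a' → (a ≡ sucP a') ↔
                          (∃₂ λ i j → outer i ≡ a × outer j ≡ a' × InnerArr T i j)
  InnerArr-between-fans a a' = irrelevant-↔ Fin-≡-irrelevant irrelevant
    (λ { refl → outer-triangle a' })
    (λ { (i , j , refl , refl , ij) → InnerStep-outerEnd _ _ ij })
    where
    irrelevant : Irrelevant (∃₂ λ i j → outer i ≡ a × outer j ≡ a' × InnerArr T i j)
    irrelevant (i , j , oi , oj , ij) (i' , j' , oi' , oj' , i'j')
      with outer-triangle-unique ij i'j' (trans oj (sym oj'))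
    ... | refl , refl = cong₂ (λ oi oj,ij → i , j , oi , oj,ij) (Fin-≡-irrelevant oi oi')
                          (cong₂ _,_ (Fin-≡-irrelevant oj oj') (InnerStep-irrelevant _ _ ij i'j'))

  OuterArr-between-fans : ∀ b b' → (b' ≡ sucQ b) ↔
                          (∃₂ λ i j → inner i ≡ b × inner j ≡ b' × OuterArr T i j)
  OuterArr-between-fans b b' = irrelevant-↔ Fin-≡-irrelevant irrelevant
    (λ { refl → inner-triangle b })
    (λ { (i , j , refl , refl , ij) → OuterStep-innerEnd _ _ ij })
    where
    irrelevant : Irrelevant (∃₂ λ i j → inner i ≡ b × inner j ≡ b' × OuterArr T i j)
    irrelevant (i , j , ii , ij′ , ij) (i' , j' , ii' , ij′' , i'j')
      with inner-triangle-unique ij i'j' (trans ii (sym ii'))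
    ... | refl , refl = cong₂ (λ ii ij,ij → i , j , ii , ij,ij) (Fin-≡-irrelevant ii ii')
                          (cong₂ _,_ (Fin-≡-irrelevant ij′ ij′') (OuterStep-irrelevant _ _ ij i'j'))

  D∞-complete : ∀ x → x ∈ D∞ T
  D∞-complete x = ∈-deduplicate⁺ (≡-dec FinP._≟_ FinP._≟_) (∈-concatMap⁺ twistLimit (end-of-arc x))
    where
    ends : ∀ γ → IsBridgingArc γ →
           inj₁ (outerEnd γ) ∈ twistLimit γ × inj₂ (innerEnd γ) ∈ twistLimit γ
    ends (bridging _ _) _ = here refl , there (here refl)
    at : ∀ {y} i → y ∈ twistLimit (arc i) → Any (λ γ → y ∈ twistLimit γ) T
    at {y} i y∈ = Any.map (λ arc≡ → subst (λ γ → y ∈ twistLimit γ) arc≡ y∈) (∈-lookup i)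
    end-of-arc : ∀ y → Any (λ γ → y ∈ twistLimit γ) T
    end-of-arc (inj₁ a) = let i , oi≡a = outer-onto a in
      at i (subst (λ a → inj₁ a ∈ twistLimit (arc i)) oi≡a (proj₁ (ends (arc i) (arc-bridging i))))
    end-of-arc (inj₂ b) = let i , ii≡b = inner-onto b in
      at i (subst (λ b → inj₂ b ∈ twistLimit (arc i)) ii≡b (proj₂ (ends (arc i) (arc-bridging i))))

  D∞-unique : Unique (D∞ T)
  D∞-unique = deduplicate-! (≡-dec FinP._≟_ FinP._≟_) _

mainTheorem7 : (p q : ℕ) .{{_ : NonZero p}} .{{_ : NonZero q}}
    (T : List (Annulus.Arc p q)) →
    Annulus.IsBridgingTriangulation p q T →
    (Q∂ Q∂' : Quiver) →
    Annulus.IsQ∂ p q T Q∂ →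
    Annulus.IsQ∂' p q T Q∂' →
    Annulus.QD p q (Annulus.D∞ p q T) ≅Q (Q∂ ⊔Q Q∂')
mainTheorem7 p q T bt Q∂ Q∂' isQ∂ isQ∂' =
  vertices , λ i j → arrows (lookup (D∞ T) i) (lookup (D∞ T) j)
  where
  open Annulus p q
  open BridgingTriangulation p q T bt
  module V  = Contraction isQ∂  outer outer-onto outer-respects outer-identifies
  module V' = Contraction isQ∂' inner inner-onto inner-respects inner-identifies

  ends-↔ : PArc ↔ (Fin (n Q∂) ⊎ Fin (n Q∂'))
  ends-↔ = V.vertex-↔ ⊎-↔ V'.vertex-↔

  ends-vertices : PArc ↔ Fin (n (Q∂ ⊔Q Q∂'))
  ends-vertices = ↔-trans ends-↔ (↔-sym FinP.+↔⊎)

  vertices : Fin (length (D∞ T)) ↔ Fin (n (Q∂ ⊔Q Q∂'))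
  vertices = ↔-trans (enumeration-↔ D∞-unique D∞-complete) ends-vertices

  PStep-↔ : ∀ x y →
            PStep x y ↔ ⊔Arr (Arr Q∂) (Arr Q∂') (Inverse.to ends-↔ x) (Inverse.to ends-↔ y)
  PStep-↔ (inj₁ a) (inj₁ a') = ↔-trans (InnerArr-between-fans a a') (↔-sym (V.vertex-arrows a a'))
  PStep-↔ (inj₁ _) (inj₂ _)  = ↔-refl
  PStep-↔ (inj₂ _) (inj₁ _)  = ↔-refl
  PStep-↔ (inj₂ b) (inj₂ b') = ↔-trans (OuterArr-between-fans b b') (↔-sym (V'.vertex-arrows b b'))

  arrows : ∀ x y → PStep x y ↔
           Arr (Q∂ ⊔Q Q∂') (Inverse.to ends-vertices x) (Inverse.to ends-vertices y)
  arrows x y = ↔-trans (PStep-↔ x y) (⊔Q-arrows Q∂ Q∂' (Inverse.to ends-↔ x) (Inverse.to ends-↔ y))
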